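{- Let $k\ge 3$, let $G=(V,E)$ be an absolute retract of $k$-chromatic graphs and let $c$ be a proper $k$-colouring of $G$. For every colour $i$ and every $u\in V_i$ with $e_i(u)\ge (d_i+5)/2\ge 7$, there exists $u'\in V_i$ with $d_G(u,u')=2$ and $e_i(u')=e_i(u)-2$.
   Context: Graphs are finite, simple (no loops), connected; $d_G$ is shortest-path distance. $V_i=\{v: c(v)=i\}$; for $v\in V_i$, $e_i(v)=\max\{d_G(w,v): w\in V_i\}$; $d_i=\max\{e_i(v): v\in V_i\}$. A $k$-chromatic graph has chromatic number exactly $k$. A subgraph $H$ of $G'$ is isometric if distances between vertices of $H$ agree in $H$ and $G'$, isochromatic if same chromatic number. A retract of $G'$ is the image of $G'$ under an idempotent edge-preserving map. An absolute retract of $k$-chromatic graphs is a $k$-chromatic graph $H$ such that whenever $H$ is an isometric and isochromatic subgraph of a $k$-chromatic graph $G'$, $H$ is a retract of $G'$. -}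

module Defs where

open import Data.Nat using (ℕ; zero; suc; _+_; _≤_; _<_)
open import Data.Fin using (Fin)
open import Data.Bool using (Bool; true; false)
open import Data.Product using (Σ; ∃; _×_; _,_)
open import Relation.Binary.PropositionalEquality using (_≡_; _≢_)
open import Relation.Nullary using (¬_)
open import Function.Bundles using (_⇔_)

record Graph : Set where
  field
    n     : ℕ
    adj   : Fin n → Fin n → Bool
    sym   : ∀ u v → adj u v ≡ adj v u
    loopless : ∀ u → adj u u ≡ false

open Graph public

Vertex : Graph → Set
Vertex G = Fin (n G)

Edge : (G : Graph) → Vertex G → Vertex G → Set
Edge G u v = adj G u v ≡ true

data Walk (G : Graph) : Vertex G → Vertex G → ℕ → Set where
  here : ∀ {u} → Walk G u u 0
  step : ∀ {u v w ℓ} → Edge G u v → Walk G v w ℓ → Walk G u w (suc ℓ)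

Connected : Graph → Set
Connected G = ∀ (u v : Vertex G) → ∃ λ ℓ → Walk G u v ℓ

Dist : (G : Graph) → Vertex G → Vertex G → ℕ → Set
Dist G u v d = Walk G u v d × (∀ m → Walk G u v m → d ≤ m)

Proper : (G : Graph) {k : ℕ} → (Vertex G → Fin k) → Set
Proper G c = ∀ u v → Edge G u v → c u ≢ c v

Colourable : Graph → ℕ → Set
Colourable G k = Σ (Vertex G → Fin k) λ c → Proper G c

Chromatic : Graph → ℕ → Set
Chromatic G k = Colourable G k × (∀ m → m < k → ¬ Colourable G m)

Hom : Graph → Graph → Set
Hom H G = Σ (Vertex H → Vertex G) λ f → ∀ u v → Edge H u v → Edge G (f u) (f v)

IsSubgraphEmb : (H G : Graph) → (Vertex H → Vertex G) → Set
IsSubgraphEmb H G φ =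
  (∀ u v → φ u ≡ φ v → u ≡ v) × (∀ u v → Edge H u v → Edge G (φ u) (φ v))

Isometric : (H G : Graph) → (Vertex H → Vertex G) → Set
Isometric H G φ = ∀ u v d → Dist H u v d ⇔ Dist G (φ u) (φ v) d

Isochromatic : Graph → Graph → Set
Isochromatic H G = ∀ k → Chromatic H k ⇔ Chromatic G k

-- H (embedded by φ) is a retract of G: an edge-preserving r : G → H with
-- r ∘ φ = id (so φ ∘ r is an idempotent edge-preserving map of G with image φ(H)).
IsRetractVia : (H G : Graph) → (Vertex H → Vertex G) → Set
IsRetractVia H G φ =
  Σ (Hom G H) λ r → ∀ x → Data.Product.proj₁ r (φ x) ≡ x
  where import Data.Product

AbsoluteRetract : ℕ → Graph → Set
AbsoluteRetract k H =
  Chromatic H k ×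
  (∀ (G : Graph) → Connected G → Chromatic G k →
     ∀ (φ : Vertex H → Vertex G) → IsSubgraphEmb H G φ →
     Isometric H G φ → Isochromatic H G → IsRetractVia H G φ)

Ecc : (G : Graph) {k : ℕ} → (Vertex G → Fin k) → Fin k → Vertex G → ℕ → Set
Ecc G c i v e =
  (∃ λ w → c w ≡ i × Dist G w v e) ×
  (∀ w d → c w ≡ i → Dist G w v d → d ≤ e)

DiamCol : (G : Graph) {k : ℕ} → (Vertex G → Fin k) → Fin k → ℕ → Set
DiamCol G c i D =
  (∃ λ v → c v ≡ i × Ecc G c i v D) ×
  (∀ v e → c v ≡ i → Ecc G c i v e → e ≤ D)

-- Let e = e_i(u). Extend G to G′ by a new vertex x of colour i, a clique y_1 … y_{k−1}
-- joined to x and to u, and for every w ∈ V_i a path of length e − 2 from w to x whose inner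
-- vertices alternate between two colours other than i (this needs k ≥ 3). Then G′ is k-chromatic,
-- and the bounds e_i(u) ≤ e and d_i ≤ 2e − 5 ensure that no route through the new vertices is
-- shorter than a distance of G, so G is an isometric, isochromatic subgraph of G′ and hence a
-- retract of it. The clique {x, y_j} uses all k colours and every y_j is adjacent to u, so the
-- retraction sends x to a vertex u′ of colour i with d(u, u′) ≤ 2 and d(u′, w) ≤ e − 2 for all
-- w ∈ V_i; a vertex of V_i at distance e from u makes both bounds sharp.
module Submission where

open import Defs hiding (sym)
open import Data.Bool using (true) renaming (_≟_ to _≟ᵇ_)
open import Data.Empty using (⊥-elim)
open import Data.Fin as Fin using (Fin; toℕ; fromℕ<; punchIn; punchOut)
import Data.Fin.Properties as Finₚ
open import Data.List using (List; filter; allFin)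
open import Data.List.Extrema.Nat
  using (argmin; argmax; argmin-all; argmax-all; f[argmin]≤f[xs]; f[xs]≤f[argmax])
import Data.List.Relation.Unary.All as All
open import Data.List.Relation.Unary.All.Properties using (all-filter)
open import Data.List.Membership.Propositional using (_∈_)
open import Data.List.Membership.Propositional.Properties using (∈-filter⁺; ∈-allFin)
open import Function.Definitions using (Injective)
open import Data.Nat
open import Data.Nat.Properties
open import Data.Nat.Tactic.RingSolver using (solve-∀)
open import Data.Product using (∃; _×_; _,_; proj₁; proj₂; uncurry)
open import Data.Sum using (_⊎_; inj₁; inj₂; [_,_]′; swap)
open import Data.Sum.Properties using (inj₁-injective)
open import Data.Sum.Function.Propositional using (_⊎-↔_)
open import Data.Unit using (⊤; tt)
open import Function.Construct.Composition using (_↔-∘_)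
open import Function.Construct.Identity using (↔-id)
open import Function.Construct.Symmetry using (↔-sym)
open import Function using (_∘_)
open import Function.Bundles using (mk⇔; _↔_; Inverse)
open import Relation.Binary using (tri<; tri≈; tri>)
open import Relation.Nullary using (¬_; Dec; yes; no)
open import Relation.Nullary.Decidable
  using (_×-dec_; _⊎-dec_; does; dec-true; dec-false; does-⇔; map′; ¬?)
open import Relation.Unary using (Decidable)
open import Relation.Binary.PropositionalEquality

Least : (ℕ → Set) → ℕ → Set
Least P m = P m × (∀ k → P k → m ≤ k)

least-below : {P : ℕ → Set} → Decidable P → ∀ n →
              (∃ (Least P)) ⊎ (∀ k → k ≤ n → ¬ P k)
least-below P? zero with P? 0
... | yes p = inj₁ (0 , p , λ _ _ → z≤n)
... | no ¬p = inj₂ λ { _ z≤n → ¬p }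
least-below P? (suc n) with least-below P? n | P? (suc n)
... | inj₁ found  | _     = inj₁ found
... | inj₂ none   | yes p = inj₁ (suc n , p , λ k pk → ≰⇒> λ k≤n → none k k≤n pk)
... | inj₂ none   | no ¬p = inj₂ λ k k≤1+n →
  [ (λ k<1+n → none k (≤-pred k<1+n)) , (λ { refl → ¬p }) ]′ (m≤n⇒m<n∨m≡n k≤1+n)

least : {P : ℕ → Set} → Decidable P → ∀ {n} → P n → ∃ (Least P)
least P? {n} pn with least-below P? n
... | inj₁ found = found
... | inj₂ none  = ⊥-elim (none n ≤-refl pn)

Lipschitz : (G : Graph) → (Vertex G → ℕ) → Set
Lipschitz G ρ = ∀ a b → Edge G a b → ρ a ≤ suc (ρ b)

Near : ℕ → ℕ → Set
Near x y = x ≤ suc y × y ≤ suc x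

near-sym : ∀ {x y} → Near x y → Near y x
near-sym (x≤ , y≤) = y≤ , x≤

near-suc : ∀ x → Near x (suc x)
near-suc x = ≤-trans (n≤1+n x) (n≤1+n (suc x)) , ≤-refl

near-+ˡ : ∀ z {x y} → Near x y → Near (z + x) (z + y)
near-+ˡ z (x≤ , y≤) = ≤-trans (+-monoʳ-≤ z x≤) (≤-reflexive (+-suc z _))
                    , ≤-trans (+-monoʳ-≤ z y≤) (≤-reflexive (+-suc z _))

near-⊓ : ∀ {x x′ y y′} → Near x x′ → Near y y′ → Near (x ⊓ y) (x′ ⊓ y′)
near-⊓ (x≤ , x′≤) (y≤ , y′≤) = ⊓-mono-≤ x≤ y≤ , ⊓-mono-≤ x′≤ y′≤

near-∸ : ∀ m t → Near (m ∸ t) (m ∸ suc t)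
near-∸ zero    zero    = z≤n , z≤n
near-∸ zero    (suc t) = z≤n , z≤n
near-∸ (suc m) zero    = near-sym (near-suc m)
near-∸ (suc m) (suc t) = near-∸ m t

module _ {G : Graph} where

  edge-sym : ∀ {a b} → Edge G a b → Edge G b a
  edge-sym {a} {b} e = trans (Graph.sym G b a) e

  _++ʷ_ : ∀ {a b c m ℓ} → Walk G a b m → Walk G b c ℓ → Walk G a c (m + ℓ)
  here     ++ʷ q = q
  step e p ++ʷ q = step e (p ++ʷ q)

  reverseʷ : ∀ {a b m} → Walk G a b m → Walk G b a m
  reverseʷ here                    = here
  reverseʷ {m = suc m} (step e p) =
    subst (Walk G _ _) (+-comm m 1) (reverseʷ p ++ʷ step (edge-sym e) here)

  walk₀ : ∀ {a b} → Walk G a b 0 → a ≡ b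
  walk₀ here = refl

  walk₁ : ∀ {a b} → Walk G a b 1 → Edge G a b
  walk₁ (step e here) = e

  walk? : ∀ m a b → Dec (Walk G a b m)
  walk? zero a b with a Fin.≟ b
  ... | yes refl = yes here
  ... | no a≢b   = no λ w → a≢b (walk₀ w)
  walk? (suc m) a b with Finₚ.any? (λ v → (adj G a v ≟ᵇ true) ×-dec walk? m v b)
  ... | yes (v , e , w) = yes (step e w)
  ... | no ¬w           = no λ { (step e w) → ¬w (_ , e , w) }

  lipschitz-walk : ∀ {ρ} → Lipschitz G ρ → ∀ {a b m} → Walk G a b m → ρ a ≤ m + ρ b
  lipschitz-walk lip here = ≤-refl
  lipschitz-walk lip (step e p) = ≤-trans (lip _ _ e) (s≤s (lipschitz-walk lip p))

mapʷ : ∀ {G H} (f : Hom G H) {a b m} → Walk G a b m → Walk H (proj₁ f a) (proj₁ f b) m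
mapʷ f here       = here
mapʷ f (step e p) = step (proj₂ f _ _ e) (mapʷ f p)

connected-via : (G : Graph) (r : Vertex G) → (∀ a → ∃ (Walk G a r)) → Connected G
connected-via G r to-r a b = _ , (proj₂ (to-r a) ++ʷ reverseʷ (proj₂ (to-r b)))

module Distance (G : Graph) (conn : Connected G) where

  private
    shortest : ∀ a b → ∃ (Dist G a b)
    shortest a b = least (λ m → walk? m a b) (proj₂ (conn a b))

  dist : Vertex G → Vertex G → ℕ
  dist a b = proj₁ (shortest a b)

  dist-Dist : ∀ a b → Dist G a b (dist a b)
  dist-Dist a b = proj₂ (shortest a b)

  dist-walk : ∀ a b → Walk G a b (dist a b)
  dist-walk a b = proj₁ (dist-Dist a b)

  dist-≤ : ∀ {a b m} → Walk G a b m → dist a b ≤ m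
  dist-≤ {a} {b} w = proj₂ (dist-Dist a b) _ w

  Dist⇒≡dist : ∀ {a b d} → Dist G a b d → d ≡ dist a b
  Dist⇒≡dist (w , minimal) = ≤-antisym (minimal _ (dist-walk _ _)) (dist-≤ w)

  dist-sym : ∀ a b → dist a b ≡ dist b a
  dist-sym a b = ≤-antisym (dist-≤ (reverseʷ (dist-walk b a))) (dist-≤ (reverseʷ (dist-walk a b)))

  dist-triangle : ∀ a b c → dist a c ≤ dist a b + dist b c
  dist-triangle a b c = dist-≤ (dist-walk a b ++ʷ dist-walk b c)

  dist-refl : ∀ a → dist a a ≡ 0
  dist-refl a = n≤0⇒n≡0 (dist-≤ {a} here)

  dist-lipschitz : ∀ b → Lipschitz G (λ a → dist a b)
  dist-lipschitz b a a′ e = dist-≤ (step e (dist-walk a′ b))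

module _ {G H : Graph} (conn : Connected G) (φ : Hom G H) where
  open Distance G conn

  LipschitzExtension : Vertex G → (Vertex H → ℕ) → Set
  LipschitzExtension b ρ = Lipschitz H ρ × (∀ a → ρ (proj₁ φ a) ≡ dist a b)

  lipschitz-extensions⇒isometric : (∀ b → ∃ (LipschitzExtension b)) → Isometric G H (proj₁ φ)
  lipschitz-extensions⇒isometric ext a b d = mk⇔ preserve reflect
    where
    dist≤walk : ∀ {m} → Walk H (proj₁ φ a) (proj₁ φ b) m → dist a b ≤ m
    dist≤walk {m} w with ext b
    ... | ρ , lip , ρ∘φ = begin
      dist a b           ≡⟨ sym (ρ∘φ a) ⟩
      ρ (proj₁ φ a)      ≤⟨ lipschitz-walk lip w ⟩
      m + ρ (proj₁ φ b)  ≡⟨ cong (m +_) (trans (ρ∘φ b) (dist-refl b)) ⟩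
      m + 0              ≡⟨ +-identityʳ m ⟩
      m                  ∎
      where open ≤-Reasoning

    preserve : Dist G a b d → Dist H (proj₁ φ a) (proj₁ φ b) d
    preserve D@(w , _) = mapʷ φ w , λ m w′ → subst (_≤ m) (sym (Dist⇒≡dist D)) (dist≤walk w′)

    reflect : Dist H (proj₁ φ a) (proj₁ φ b) d → Dist G a b d
    reflect (w′ , minimal) = subst (Dist G a b) (sym d≡dist) (dist-Dist a b)
      where
      d≡dist : d ≡ dist a b
      d≡dist = ≤-antisym (minimal _ (mapʷ φ (dist-walk a b))) (dist≤walk w′)

module ColourClass (G : Graph) {k : ℕ} (c : Vertex G → Fin k) (i : Fin k) where

  private
    in-class? : ∀ w → Dec (c w ≡ i)
    in-class? w = c w Fin.≟ i

    members : List (Vertex G)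
    members = filter in-class? (allFin (n G))

    ∈members : ∀ {w} → c w ≡ i → w ∈ members
    ∈members {w} cw = ∈-filter⁺ in-class? (∈-allFin w) cw

  class-argmin : (f : Vertex G → ℕ) → ∀ {v} → c v ≡ i →
                 ∃ λ m → c m ≡ i × ∀ w → c w ≡ i → f m ≤ f w
  class-argmin f {v} cv =
    argmin f v members , argmin-all f cv (all-filter in-class? (allFin (n G))) ,
    λ w cw → All.lookup (f[argmin]≤f[xs] v members) (∈members cw)

  class-argmax : (f : Vertex G → ℕ) → ∀ {v} → c v ≡ i →
                 ∃ λ m → c m ≡ i × ∀ w → c w ≡ i → f w ≤ f m
  class-argmax f {v} cv =
    argmax f v members , argmax-all f cv (all-filter in-class? (allFin (n G))) ,
    λ w cw → All.lookup (f[xs]≤f[argmax] v members) (∈members cw)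

  module _ (conn : Connected G) where
    open Distance G conn

    ecc-exists : ∀ {b} → c b ≡ i → ∃ (Ecc G c i b)
    ecc-exists {b} cb with class-argmax (λ w → dist w b) cb
    ... | far , cfar , farthest =
      dist far b , (far , cfar , dist-Dist far b) ,
      λ w d cw D → subst (_≤ dist far b) (sym (Dist⇒≡dist D)) (farthest w cw)

    Ecc⇒dist≤ : ∀ {u e w} → Ecc G c i u e → c w ≡ i → dist w u ≤ e
    Ecc⇒dist≤ {u} {w = w} (_ , within) cw = within w _ cw (dist-Dist w u)

    DiamCol⇒dist≤ : ∀ {D a b} → DiamCol G c i D → c a ≡ i → c b ≡ i → dist a b ≤ D
    DiamCol⇒dist≤ (_ , bounded) ca cb with ecc-exists cb
    ... | e , ecc = ≤-trans (Ecc⇒dist≤ ecc ca) (bounded _ e cb ecc)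

Shortcut : (G : Graph) {k : ℕ} → (Vertex G → Fin k) → Fin k → Vertex G → ℕ → Vertex G → Set
Shortcut G c i u e u′ = c u′ ≡ i × Walk G u u′ 2 × (∀ w → c w ≡ i → Walk G u′ w e)

shortcut⇒eccentricity : ∀ {G k} {c : Vertex G → Fin k} {i u e} → Proper G c → c u ≡ i →
  Ecc G c i u (2 + e) → ∃ (Shortcut G c i u e) →
  ∃ λ u′ → c u′ ≡ i × Dist G u u′ 2 × Ecc G c i u′ e
shortcut⇒eccentricity {G} {u = u} {e} proper cu ((far , cfar , _ , far-minimal) , _)
                      (u′ , cu′ , u-to-u′ , u′-to) =
  u′ , cu′ , (u-to-u′ , minimal) , (far , cfar , far-to-u′ , λ m w → e≤via-u′ w) ,
  λ w d cw D → proj₂ D e (reverseʷ (u′-to w cw))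
  where
  far-to-u′ : Walk G far u′ e
  far-to-u′ = reverseʷ (u′-to far cfar)

  e≤via-u′ : ∀ {m} → Walk G far u′ m → e ≤ m
  e≤via-u′ {m} w =
    +-cancelˡ-≤ 2 e m (subst (2 + e ≤_) (+-comm m 2) (far-minimal _ (w ++ʷ reverseʷ u-to-u′)))

  minimal : ∀ m → Walk G u u′ m → 2 ≤ m
  minimal zero          w = ⊥-elim (1+n≰n (≤-trans (n≤1+n (suc e)) (far-minimal e far-to-u)))
    where
    far-to-u : Walk G far u e
    far-to-u = subst (λ x → Walk G far x e) (sym (walk₀ w)) far-to-u′
  minimal (suc zero)    w = ⊥-elim (proper u u′ (walk₁ w) (trans cu (sym cu′)))
  minimal (suc (suc m)) w = s≤s (s≤s z≤n)

chromatic-unique : ∀ {G k m} → Chromatic G k → Chromatic G m → k ≡ m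
chromatic-unique {k = k} {m} (col-k , min-k) (col-m , min-m) with <-cmp k m
... | tri< k<m _ _ = ⊥-elim (min-m k k<m col-k)
... | tri≈ _ k≡m _ = k≡m
... | tri> _ _ m<k = ⊥-elim (min-k m m<k col-m)

colourable-pullback : ∀ {G H k} → Hom G H → Colourable H k → Colourable G k
colourable-pullback (f , f-hom) (c , proper) =
  (λ a → c (f a)) , λ a b e → proper (f a) (f b) (f-hom a b e)

hom⇒chromatic : ∀ {G H k} → Hom G H → Chromatic G k → Colourable H k → Chromatic H k
hom⇒chromatic {G} {H} f (_ , minimal) col-H =
  col-H , λ m m<k col-m → minimal m m<k (colourable-pullback {G} {H} f col-m)

chromatic⇒isochromatic : ∀ {G H k} → Chromatic G k → Chromatic H k → Isochromatic G H
chromatic⇒isochromatic {G} {H} χG χH m = mk⇔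
  (λ χ → subst (Chromatic H) (chromatic-unique {G} χG χ) χH)
  (λ χ → subst (Chromatic G) (chromatic-unique {H} χH χ) χG)

clique-meets-every-colour : ∀ {G k} (c : Vertex G → Fin (suc k)) → Proper G c →
  (f : Fin (suc k) → Vertex G) → (∀ a b → a ≢ b → Edge G (f a) (f b)) →
  ∀ i → ∃ λ a → c (f a) ≡ i
clique-meets-every-colour c proper f clique i
  with Finₚ.any? (λ a → c (f a) Fin.≟ i)
... | yes found = found
... | no missed = ⊥-elim (1+n≰n (Finₚ.injective⇒≤ squeeze-injective))
  where
  avoids : ∀ a → i ≢ c (f a)
  avoids a i≡ = missed (a , sym i≡)

  squeeze-injective : Injective _≡_ _≡_ (λ a → punchOut (avoids a))
  squeeze-injective {a} {b} eq with a Fin.≟ b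
  ... | yes a≡b = a≡b
  ... | no a≢b  =
    ⊥-elim (proper _ _ (clique a b a≢b) (Finₚ.punchOut-injective (avoids a) (avoids b) eq))

module FiniteGraph {V : Set} {N : ℕ} (layout : V ↔ Fin N)
                   (R : V → V → Set) (R? : ∀ p q → Dec (R p q))
                   (R-sym : ∀ {p q} → R p q → R q p) (R-irrefl : ∀ {p} → ¬ R p p) where
  open Inverse layout using (to; from; strictlyInverseʳ)

  graph : Graph
  graph = record
    { n        = N
    ; adj      = λ f g → does (R? (from f) (from g))
    ; sym      = λ f g → does-⇔ (mk⇔ R-sym R-sym) (R? (from f) (from g)) (R? (from g) (from f))
    ; loopless = λ f → dec-false (R? (from f) (from f)) R-irrefl
    }

  edge⁺ : ∀ {p q} → R p q → Edge graph (to p) (to q)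
  edge⁺ {p} {q} r rewrite strictlyInverseʳ p | strictlyInverseʳ q = dec-true (R? p q) r

  edge⁻ : ∀ {f g} → Edge graph f g → R (from f) (from g)
  edge⁻ {f} {g} = witness (R? (from f) (from g))
    where
    witness : ∀ {P} (p? : Dec P) → does p? ≡ true → P
    witness (yes p) _ = p

module Extension (G : Graph) {k : ℕ} (c : Vertex G → Fin (3 + k)) (i : Fin (3 + k))
                 (u : Vertex G) (ℓ : ℕ) where

  M : ℕ
  M = suc ℓ

  -- The old vertices, the hub x, the spokes y_j, and the inner vertices of the path from w to x,
  -- indexed by their distance to x minus one; the path has M + 1 = e − 2 edges.
  V′ : Set
  V′ = Vertex G ⊎ (⊤ ⊎ (Fin (2 + k) ⊎ (Vertex G × Fin M)))

  pattern old a    = inj₁ a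
  pattern hub      = inj₂ (inj₁ tt)
  pattern spoke j  = inj₂ (inj₂ (inj₁ j))
  pattern path w t = inj₂ (inj₂ (inj₂ (w , t)))

  layout : V′ ↔ Fin (n G + (1 + (2 + k + n G * M)))
  layout = ↔-sym ((↔-id _ ⊎-↔ ((Finₚ.1↔⊤ ⊎-↔ ((↔-id _ ⊎-↔ Finₚ.*↔×) ↔-∘ Finₚ.+↔⊎)) ↔-∘ Finₚ.+↔⊎))
                   ↔-∘ Finₚ.+↔⊎)

  data Link : V′ → V′ → Set where
    old-old     : ∀ {a b} → Edge G a b → Link (old a) (old b)
    spoke-u     : ∀ {j} → Link (spoke j) (old u)
    hub-spoke   : ∀ {j} → Link hub (spoke j)
    spoke-spoke : ∀ {j j′} → j ≢ j′ → Link (spoke j) (spoke j′)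
    hub-path    : ∀ {w t} → toℕ t ≡ 0 → Link hub (path w t)
    path-path   : ∀ {w t t′} → suc (toℕ t) ≡ toℕ t′ → Link (path w t) (path w t′)
    path-end    : ∀ {w t} → c w ≡ i → suc (toℕ t) ≡ M → Link (path w t) (old w)

  link? : ∀ p q → Dec (Link p q)
  link? (old a)    (old b)      = map′ old-old (λ { (old-old e) → e }) (adj G a b ≟ᵇ true)
  link? (spoke j)  (old a)      = map′ (λ { refl → spoke-u }) (λ { spoke-u → refl }) (a Fin.≟ u)
  link? hub        (spoke j)    = yes hub-spoke
  link? (spoke j)  (spoke j′)   = map′ spoke-spoke (λ { (spoke-spoke ≢) → ≢ }) (¬? (j Fin.≟ j′))
  link? hub        (path w t)   = map′ hub-path (λ { (hub-path t≡0) → t≡0 }) (toℕ t ≟ 0)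
  link? (path w t) (path w′ t′) with w Fin.≟ w′
  ... | no w≢w′ = no λ { (path-path _) → w≢w′ refl }
  ... | yes refl = map′ path-path (λ { (path-path t+1≡t′) → t+1≡t′ }) (suc (toℕ t) ≟ toℕ t′)
  link? (path w t) (old a) with w Fin.≟ a
  ... | no w≢a = no λ { (path-end _ _) → w≢a refl }
  ... | yes refl = map′ (uncurry path-end) (λ { (path-end cw end) → cw , end })
                        ((c w Fin.≟ i) ×-dec (suc (toℕ t) ≟ M))
  link? (old _)    hub          = no λ ()
  link? (old _)    (spoke _)    = no λ ()
  link? (old _)    (path _ _)   = no λ ()
  link? hub        (old _)      = no λ ()
  link? hub        hub          = no λ ()
  link? (spoke _)  hub          = no λ ()
  link? (spoke _)  (path _ _)   = no λ ()
  link? (path _ _) hub          = no λ ()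
  link? (path _ _) (spoke _)    = no λ ()

  link-irrefl : ∀ {p} → ¬ Link p p
  link-irrefl {old a} (old-old e)     with trans (sym e) (loopless G a)
  ... | ()
  link-irrefl (spoke-spoke j≢j)       = j≢j refl
  link-irrefl (path-path t+1≡t)       = 1+n≢n t+1≡t

  Adjacent : V′ → V′ → Set
  Adjacent p q = Link p q ⊎ Link q p

  open FiniteGraph layout Adjacent (λ p q → link? p q ⊎-dec link? q p) swap
                   [ link-irrefl , link-irrefl ]′
    public renaming (graph to G′)

  vertex : V′ → Vertex G′
  vertex = Inverse.to layout

  link⁺ : ∀ {p q} → Link p q → Edge G′ (vertex p) (vertex q)
  link⁺ l = edge⁺ (inj₁ l)

  link⁻ : ∀ {p q} → Link p q → Edge G′ (vertex q) (vertex p)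
  link⁻ l = edge⁺ (inj₂ l)

  φ : Vertex G → Vertex G′
  φ a = vertex (old a)

  φ-hom : Hom G G′
  φ-hom = φ , λ a b e → link⁺ (old-old e)

  φ-embedding : IsSubgraphEmb G G′ φ
  φ-embedding = φ-injective , proj₂ φ-hom
    where
    φ-injective : ∀ a b → φ a ≡ φ b → a ≡ b
    φ-injective a b eq = inj₁-injective (begin
      old a                          ≡⟨ sym (Inverse.strictlyInverseʳ layout (old a)) ⟩
      Inverse.from layout (φ a)      ≡⟨ cong (Inverse.from layout) eq ⟩
      Inverse.from layout (φ b)      ≡⟨ Inverse.strictlyInverseʳ layout (old b) ⟩
      old b                          ∎)
      where open ≡-Reasoning

  alternating : ℕ → Fin (2 + k)
  alternating zero          = Fin.zero
  alternating (suc zero)    = Fin.suc Fin.zero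
  alternating (suc (suc s)) = alternating s

  alternating-suc : ∀ s → alternating s ≢ alternating (suc s)
  alternating-suc zero          ()
  alternating-suc (suc zero)    ()
  alternating-suc (suc (suc s)) = alternating-suc s

  colour : V′ → Fin (3 + k)
  colour (old a)    = c a
  colour hub        = i
  colour (spoke j)  = punchIn i j
  colour (path w t) = punchIn i (alternating (toℕ t))

  link-proper : Proper G c → c u ≡ i → ∀ {p q} → Link p q → colour p ≢ colour q
  link-proper proper cu (old-old e)           = proper _ _ e
  link-proper proper cu spoke-u               = λ eq → Finₚ.punchInᵢ≢i i _ (trans eq cu)
  link-proper proper cu hub-spoke             = λ eq → Finₚ.punchInᵢ≢i i _ (sym eq)
  link-proper proper cu (spoke-spoke j≢j′)    = λ eq → j≢j′ (Finₚ.punchIn-injective i _ _ eq)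
  link-proper proper cu (hub-path _)          = λ eq → Finₚ.punchInᵢ≢i i _ (sym eq)
  link-proper proper cu (path-path {t = t} t+1≡t′) eq rewrite sym t+1≡t′ =
    alternating-suc (toℕ t) (Finₚ.punchIn-injective i _ _ eq)
  link-proper proper cu (path-end cw _)       = λ eq → Finₚ.punchInᵢ≢i i _ (trans eq cw)

  colour′ : Vertex G′ → Fin (3 + k)
  colour′ f = colour (Inverse.from layout f)

  colour′-proper : Proper G c → c u ≡ i → Proper G′ colour′
  colour′-proper proper cu f g e with edge⁻ e
  ... | inj₁ l = link-proper proper cu l
  ... | inj₂ l = link-proper proper cu l ∘ sym

  chromatic′ : Proper G c → c u ≡ i → Chromatic G (3 + k) → Chromatic G′ (3 + k)
  chromatic′ proper cu χ = hom⇒chromatic {G} {G′} φ-hom χ (colour′ , colour′-proper proper cu)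

  descend : ∀ w s (s<M : s < M) → Walk G′ (vertex (path w (fromℕ< s<M))) (vertex hub) (suc s)
  descend w zero    s<M = step (link⁻ (hub-path (Finₚ.toℕ-fromℕ< s<M))) here
  descend w (suc s) s<M = step (link⁻ (path-path s+1≡)) (descend w s s<M′)
    where
    s<M′ : s < M
    s<M′ = <-trans (n<1+n s) s<M
    s+1≡ : suc (toℕ (fromℕ< s<M′)) ≡ toℕ (fromℕ< s<M)
    s+1≡ = trans (cong suc (Finₚ.toℕ-fromℕ< s<M′)) (sym (Finₚ.toℕ-fromℕ< s<M))

  path-to-hub : ∀ w t → Walk G′ (vertex (path w t)) (vertex hub) (suc (toℕ t))
  path-to-hub w t = subst (λ t′ → Walk G′ (vertex (path w t′)) (vertex hub) (suc (toℕ t)))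
                          (Finₚ.fromℕ<-toℕ t (Finₚ.toℕ<n t)) (descend w (toℕ t) (Finₚ.toℕ<n t))

  class-to-hub : ∀ {w} → c w ≡ i → Walk G′ (φ w) (vertex hub) (suc M)
  class-to-hub {w} cw = step (link⁻ (path-end cw (cong suc end)))
                             (subst (λ m → Walk G′ (vertex (path w last)) (vertex hub) (suc m)) end
                                    (path-to-hub w last))
    where
    last : Fin M
    last = Fin.fromℕ ℓ
    end : toℕ last ≡ ℓ
    end = Finₚ.toℕ-fromℕ ℓ

  hub-to-u : Walk G′ (vertex hub) (φ u) 2
  hub-to-u = step (link⁺ (hub-spoke {Fin.zero})) (step (link⁺ spoke-u) here)

  connected′ : Connected G → Connected G′
  connected′ conn = connected-via G′ (φ u) λ f →
    subst (λ f → ∃ (Walk G′ f (φ u))) (Inverse.strictlyInverseˡ layout f)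
          (reach (Inverse.from layout f))
    where
    reach : ∀ p → ∃ (Walk G′ (vertex p) (φ u))
    reach (old a)    = _ , mapʷ φ-hom (proj₂ (conn a u))
    reach hub        = _ , hub-to-u
    reach (spoke j)  = _ , step (link⁺ spoke-u) here
    reach (path w t) = _ , (path-to-hub w t ++ʷ hub-to-u)

  module Isometry (conn : Connected G) (cu : c u ≡ i) where
    open Distance G conn

    module _ (ecc-bound : ∀ w → c w ≡ i → dist w u ≤ 3 + M)
             (diam-bound : ∀ a b → c a ≡ i → c b ≡ i → dist a b ≤ suc M + suc M)
             (b : Vertex G) where

      private
        nearest : ∃ λ m → c m ≡ i × ∀ w → c w ≡ i → dist m b ≤ dist w b
        nearest = ColourClass.class-argmin G c i (λ w → dist w b) cu

      w₀ : Vertex G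
      w₀ = proj₁ nearest

      A T via-u via-class hub-pot : ℕ
      A         = dist u b
      T         = dist w₀ b
      via-u     = suc (suc A)
      via-class = T + suc M
      hub-pot   = via-u ⊓ via-class

      reach : Vertex G → ℕ
      reach w = T ⊔ dist w b

      -- The distance to b that G′ would have: the hub is reached from b through u (A + 2) or
      -- through the nearest class vertex w₀ and its path (T + M + 1), and a path vertex from the
      -- hub or from its own endpoint. Paths of vertices outside V_i are attached to the hub only;
      -- the lower cap T in reach keeps ρ Lipschitz there and changes nothing on V_i.
      ρ : V′ → ℕ
      ρ (old a)    = dist a b
      ρ hub        = hub-pot
      ρ (spoke j)  = suc (A ⊓ via-class)
      ρ (path w t) = (hub-pot + suc (toℕ t)) ⊓ (reach w + (M ∸ toℕ t))

      u-close : A ≤ suc (suc via-class)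
      u-close = begin
        dist u b              ≤⟨ dist-triangle u w₀ b ⟩
        dist u w₀ + T         ≤⟨ +-monoˡ-≤ T (≤-trans (≤-reflexive (dist-sym u w₀))
                                                         (ecc-bound w₀ (proj₁ (proj₂ nearest)))) ⟩
        3 + M + T             ≡⟨ cong suc (cong suc (+-comm (suc M) T)) ⟩
        suc (suc via-class)   ∎
        where open ≤-Reasoning

      -- The hypotheses e_i(u) ≤ e and d_i ≤ 2e − 5 enter here: the paths and the hub create no
      -- shortcut between two vertices of G.
      class-bound : ∀ {a} → c a ≡ i → dist a b ≤ suc (hub-pot + M)
      class-bound {a} ca = subst (dist a b ≤_) (cong suc (sym (+-distribʳ-⊓ M via-u via-class)))
                                 (⊓-glb through-u through-w₀)
        where
        open ≤-Reasoning
        through-u : dist a b ≤ suc (via-u + M)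
        through-u = begin
          dist a b         ≤⟨ dist-triangle a u b ⟩
          dist a u + A     ≤⟨ +-monoˡ-≤ A (ecc-bound a ca) ⟩
          3 + M + A        ≡⟨ cong (suc ∘ suc ∘ suc) (+-comm M A) ⟩
          suc (via-u + M)  ∎
        through-w₀ : dist a b ≤ suc (via-class + M)
        through-w₀ = begin
          dist a b                ≤⟨ dist-triangle a w₀ b ⟩
          dist a w₀ + T           ≤⟨ +-monoˡ-≤ T (diam-bound a w₀ ca (proj₁ (proj₂ nearest))) ⟩
          suc M + suc M + T       ≡⟨ rearrange M T ⟩
          suc (via-class + M)     ∎
          where
          rearrange : ∀ M T → suc M + suc M + T ≡ suc (T + suc M + M)
          rearrange = solve-∀

      reach-class : ∀ {w} → c w ≡ i → reach w ≡ dist w b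
      reach-class {w} cw = m≤n⇒m⊔n≡n (proj₂ (proj₂ nearest) w cw)

      hub-pot≤reach : ∀ w → hub-pot ≤ suc (reach w + M)
      hub-pot≤reach w = begin
        hub-pot              ≤⟨ m⊓n≤n via-u via-class ⟩
        T + suc M            ≤⟨ +-monoˡ-≤ (suc M) (m≤m⊔n T (dist w b)) ⟩
        reach w + suc M      ≡⟨ +-suc (reach w) M ⟩
        suc (reach w + M)    ∎
        where open ≤-Reasoning

      link-near : ∀ {p q} → Link p q → Near (ρ p) (ρ q)
      link-near (old-old e) = dist-lipschitz b _ _ e , dist-lipschitz b _ _ (edge-sym {G} e)
      link-near spoke-u =
        s≤s (m⊓n≤m A via-class) , ⊓-glb (≤-trans (n≤1+n A) (n≤1+n (suc A))) u-close
      link-near hub-spoke =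
        ⊓-mono-≤ ≤-refl (≤-trans (n≤1+n via-class) (n≤1+n _)) ,
        s≤s (⊓-monoˡ-≤ via-class (≤-trans (n≤1+n A) (n≤1+n (suc A))))
      link-near (spoke-spoke _) = n≤1+n _ , n≤1+n _
      link-near (hub-path {w} {t} t≡0) rewrite t≡0 =
        ⊓-glb (≤-trans (m≤m+n hub-pot 1) (n≤1+n _)) (hub-pot≤reach w) ,
        ≤-trans (m⊓n≤m _ _) (≤-reflexive (+-comm hub-pot 1))
      link-near (path-path {w} {t} t+1≡t′) rewrite sym t+1≡t′ =
        near-⊓ (near-+ˡ hub-pot (near-suc (suc (toℕ t)))) (near-+ˡ (reach w) (near-∸ M (toℕ t)))
      link-near (path-end {w} {t} cw t+1≡M) =
        ≤-trans (m⊓n≤n _ _) (≤-reflexive last-step) ,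
        ⊓-glb (subst (λ m → dist w b ≤ suc (hub-pot + m)) (sym t+1≡M) (class-bound cw))
              (≤-trans (m≤n⊔m T (dist w b)) (≤-trans (m≤m+n (reach w) _) (n≤1+n _)))
        where
        last-step : reach w + (M ∸ toℕ t) ≡ suc (dist w b)
        last-step = begin-equality
          reach w + (M ∸ toℕ t)
            ≡⟨ cong₂ _+_ (reach-class cw) (cong (_∸ toℕ t) (sym t+1≡M)) ⟩
          dist w b + (suc (toℕ t) ∸ toℕ t)
            ≡⟨ cong (dist w b +_) (m+n∸n≡m 1 (toℕ t)) ⟩
          dist w b + 1
            ≡⟨ +-comm (dist w b) 1 ⟩
          suc (dist w b)
            ∎
          where open ≤-Reasoning

      extension : LipschitzExtension {G} {G′} conn φ-hom b (ρ ∘ Inverse.from layout)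
      extension = lipschitz , λ a → cong ρ (Inverse.strictlyInverseʳ layout (old a))
        where
        lipschitz : Lipschitz G′ (ρ ∘ Inverse.from layout)
        lipschitz f g e with edge⁻ e
        ... | inj₁ l = proj₁ (link-near l)
        ... | inj₂ l = proj₂ (link-near l)

    isometric : (∀ w → c w ≡ i → dist w u ≤ 3 + M) →
                (∀ a b → c a ≡ i → c b ≡ i → dist a b ≤ suc M + suc M) →
                Isometric G G′ φ
    isometric ecc-bound diam-bound =
      lipschitz-extensions⇒isometric conn φ-hom λ b → _ , extension ecc-bound diam-bound b

  retract-shortcut : Proper G c → c u ≡ i → IsRetractVia G G′ φ → ∃ (Shortcut G c i u (suc M))
  retract-shortcut proper cu (r , r∘φ) = u′ , u′-colour , u-to-u′ , u′-to-class
    where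
    u′ : Vertex G
    u′ = proj₁ r (vertex hub)

    clique : Fin (3 + k) → Vertex G′
    clique Fin.zero    = vertex hub
    clique (Fin.suc j) = vertex (spoke j)

    clique-edge : ∀ a b → a ≢ b → Edge G′ (clique a) (clique b)
    clique-edge Fin.zero    Fin.zero    a≢b = ⊥-elim (a≢b refl)
    clique-edge Fin.zero    (Fin.suc _) _   = link⁺ hub-spoke
    clique-edge (Fin.suc _) Fin.zero    _   = link⁻ hub-spoke
    clique-edge (Fin.suc a) (Fin.suc b) a≢b = link⁺ (spoke-spoke (a≢b ∘ cong Fin.suc))

    spoke-colour : ∀ j → c (proj₁ r (vertex (spoke j))) ≢ i
    spoke-colour j eq = proper u y (subst (λ x → Edge G x y) (r∘φ u) (proj₂ r _ _ (link⁻ spoke-u)))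
                                   (trans cu (sym eq))
      where
      y : Vertex G
      y = proj₁ r (vertex (spoke j))

    -- The hub and the spokes form a k-clique, and no spoke has colour i since it is adjacent to u.
    u′-colour : c u′ ≡ i
    u′-colour with clique-meets-every-colour {G} c proper (proj₁ r ∘ clique)
                     (λ a b a≢b → proj₂ r _ _ (clique-edge a b a≢b)) i
    ... | Fin.zero  , c≡i = c≡i
    ... | Fin.suc j , c≡i = ⊥-elim (spoke-colour j c≡i)

    u-to-u′ : Walk G u u′ 2
    u-to-u′ = subst (λ x → Walk G x u′ 2) (r∘φ u) (mapʷ r (reverseʷ hub-to-u))

    u′-to-class : ∀ w → c w ≡ i → Walk G u′ w (suc M)
    u′-to-class w cw =
      subst (λ x → Walk G u′ x (suc M)) (r∘φ w) (mapʷ r (reverseʷ (class-to-hub cw)))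

e≥4 : ∀ {D e} → D + 5 ≤ 2 * e → 14 ≤ D + 5 → 4 ≤ e
e≥4 {D} {e} D+5≤2e 14≤D+5 =
  ≤-trans (s≤s (s≤s (s≤s (s≤s z≤n)))) (*-cancelˡ-≤ {7} {e} 2 (≤-trans 14≤D+5 D+5≤2e))

diameter-slack : ∀ D ℓ → D + 5 ≤ 2 * (4 + ℓ) → D ≤ (2 + ℓ) + (2 + ℓ)
diameter-slack D ℓ D+5≤ =
  ≤-trans (n≤1+n D) (+-cancelʳ-≤ 4 (suc D) ((2 + ℓ) + (2 + ℓ)) (subst₂ _≤_ (lhs D) (rhs ℓ) D+5≤))
  where
  lhs : ∀ D → D + 5 ≡ suc D + 4
  lhs = solve-∀
  rhs : ∀ ℓ → 2 * (4 + ℓ) ≡ (2 + ℓ) + (2 + ℓ) + 4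
  rhs = solve-∀

lemma34 : (k : ℕ) → 3 ≤ k → (G : Graph) → Connected G → AbsoluteRetract k G →
    (c : Vertex G → Fin k) → Proper G c →
    ∀ (i : Fin k) (u : Vertex G) → c u ≡ i →
    ∀ (e D : ℕ) → Ecc G c i u e → DiamCol G c i D →
    D + 5 ≤ 2 * e → 14 ≤ D + 5 →
    ∃ λ u′ → c u′ ≡ i × Dist G u u′ 2 × Ecc G c i u′ (e ∸ 2)
lemma34 (suc (suc (suc k))) (s≤s (s≤s (s≤s z≤n))) G conn (χ , absolute) c proper i u cu
        e D ecc diam D+5≤2e 14≤D+5
  with e≥4 {D} {e} D+5≤2e 14≤D+5
... | s≤s (s≤s (s≤s (s≤s {n = ℓ} _))) =
  shortcut⇒eccentricity proper cu ecc (retract-shortcut proper cu retraction)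
  where
  open Extension G c i u ℓ
  open ColourClass G c i

  χ′ : Chromatic G′ (3 + k)
  χ′ = chromatic′ proper cu χ

  isometric′ : Isometric G G′ φ
  isometric′ = Isometry.isometric conn cu (λ w cw → Ecc⇒dist≤ conn ecc cw)
    (λ a b ca cb → ≤-trans (DiamCol⇒dist≤ conn diam ca cb) (diameter-slack D ℓ D+5≤2e))

  retraction : IsRetractVia G G′ φ
  retraction = absolute G′ (connected′ conn) χ′ φ φ-embedding isometric′
                        (chromatic⇒isochromatic {G} {G′} χ χ′)
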